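{- Let $n \geq 2$, let $\pi$ be an exceptional permutation of size $2(n+1)$, let $P$ be a set of $n$ entries (points) of $\pi$, and let $\pi'$ be the exceptional permutation of size $2n$ of the same type as $\pi$. Then there exists an occurrence of the pattern $\pi'$ in $\pi$ which contains all points of $P$; that is, there are positions $i_1<\dots<i_{2n}$ such that $\pi_{i_1}\cdots\pi_{i_{2n}}$ is order-isomorphic to $\pi'$ and every point of $P$ is at one of the positions $i_1,\dots,i_{2n}$.
   Context: A permutation of size $n$ is a bijection $\pi$ of $\{1,\dots,n\}$, written $\pi=\pi_1\cdots\pi_n$. For every $m\geq 2$ the exceptional permutations of size $2m$ are: type 1: $2\,4\,6\cdots(2m)\,1\,3\cdots(2m-1)$; type 2: $(2m-1)\,(2m-3)\cdots1\,(2m)\,(2m-2)\cdots2$; type 3: $(m+1)\,1\,(m+2)\,2\cdots(2m)\,m$; type 4: $m\,(2m)\,(m-1)\,(2m-1)\cdots1\,(m+1)$. A permutation is exceptional if it is one of these; its type is the corresponding index. -}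

module Defs where

open import Data.Nat using (ℕ; zero; suc; _+_; _*_; _∸_; _<_; _<ᵇ_)
open import Data.Nat.DivMod using (_/_; _%_)
open import Data.Bool using (if_then_else_)
open import Data.Fin using (Fin; toℕ)
open import Data.Fin.Subset using (Subset; _∈_; ∣_∣)
open import Data.Product using (Σ; ∃; _×_)
open import Relation.Binary.PropositionalEquality using (_≡_)

data ExcType : Set where
  type1 type2 type3 type4 : ExcType

-- exc t m j = the (1-based) value at the (0-based) position j of the
-- exceptional permutation of type t and size 2m, for j < 2m.
--   type 1: 2 4 6 ... (2m) 1 3 ... (2m-1)
--   type 2: (2m-1) (2m-3) ... 1 (2m) (2m-2) ... 2
--   type 3: (m+1) 1 (m+2) 2 ... (2m) m
--   type 4: m (2m) (m-1) (2m-1) ... 1 (m+1)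
exc : ExcType → ℕ → ℕ → ℕ
exc type1 m j = if j <ᵇ m then 2 * (j + 1) else 2 * (j ∸ m) + 1
exc type2 m j = if j <ᵇ m then 2 * m ∸ (2 * j + 1) else 2 * m ∸ 2 * (j ∸ m)
exc type3 m j = if (j % 2) <ᵇ 1 then m + 1 + j / 2 else j / 2 + 1
exc type4 m j = if (j % 2) <ᵇ 1 then m ∸ j / 2 else 2 * m ∸ j / 2

excPerm : (t : ExcType) (m : ℕ) → Fin (2 * m) → ℕ
excPerm t m i = exc t m (toℕ i)

record Occurrence {k N : ℕ} (σ : Fin k → ℕ) (π : Fin N → ℕ) : Set where
  field
    pos        : Fin k → Fin N
    increasing : ∀ a b → toℕ a < toℕ b → toℕ (pos a) < toℕ (pos b)
    orderIso   : ∀ a b → (σ a < σ b → π (pos a) < π (pos b))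
                       × (π (pos a) < π (pos b) → σ a < σ b)

-- The occurrence contains every point of P (points identified by their positions).
Contains : {k N : ℕ} {σ : Fin k → ℕ} {π : Fin N → ℕ} →
           Occurrence σ π → Subset N → Set
Contains {k} occ P = ∀ p → p ∈ P → ∃ λ (a : Fin k) → Occurrence.pos occ a ≡ p

-- Deleting two suitably placed entries from the exceptional permutation of size
-- 2n + 2 leaves an occurrence of the one of size 2n: for types 1 and 2 the entries at
-- (0-based) positions c and n + 1 + e, for types 3 and 4 those at positions c + e and
-- c + e + 1, whenever c ≤ e ≤ c + 1 and e ≤ n.  Types 2 and 4 are the reversals of
-- types 1 and 3, and reversal permutes these families of pairs.  It remains to find
-- such a pair outside P.  Reading the membership bits of P along the positions in
-- their natural order (types 3, 4), or in the order n + 1, 0, n + 2, 1, ... (types 1, 2),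
-- the admissible pairs are exactly the consecutive ones, and a word of 2n + 2 bits
-- with only n ones has two consecutive zeros: without them it would have at most one
-- more zero than ones.

module Submission where

open import Defs
open import Data.Nat using (ℕ; zero; suc; _+_; _*_; _∸_; _≤_; _<_; _<?_; _≤?_; _<ᵇ_; z≤n; s≤s)
open import Data.Nat.Properties
open import Data.Nat.DivMod using (_/_; _%_; m*n%n≡0; m*n/n≡m; [m+kn]%n≡m%n; +-distrib-/)
open import Data.Nat.Tactic.RingSolver using (solve-∀)
open import Data.Bool using (Bool; true; false; if_then_else_; T)
open import Data.List using (List; []; _∷_; _++_; length; take; drop)
open import Data.List.Properties using (length-take; length-drop; take++drop≡id)
open import Data.Vec using (toList; lookup) renaming ([] to []ᵥ; _∷_ to _∷ᵥ_)
open import Data.Vec.Properties using (length-toList; []=⇒lookup)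
open import Data.Fin using (Fin; toℕ; fromℕ<; opposite) renaming (zero to fzero; suc to fsuc)
open import Data.Fin.Properties using (toℕ<n; toℕ-fromℕ<; toℕ-injective; opposite-prop; opposite-involutive)
open import Data.Fin.Subset using (Subset; ∣_∣; _∈_)
open import Data.Product using (Σ; ∃; ∃₂; _×_; _,_; proj₁; proj₂)
open import Data.Sum using (_⊎_; inj₁; inj₂)
open import Function using (_∘_; _∘′_)
open import Relation.Binary.Core using (_Preserves_⟶_)
open import Relation.Binary.Definitions using (tri<; tri≈; tri>)
open import Relation.Binary.PropositionalEquality
open import Relation.Nullary using (¬_; yes; no; contradiction)

private variable
  j m p q x y : ℕ

if-true : ∀ {A : Set} {b} {x y : A} → T b → (if b then x else y) ≡ x
if-true {b = true} _ = refl

if-false : ∀ {A : Set} {b} {x y : A} → ¬ T b → (if b then x else y) ≡ y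
if-false {b = false} _ = refl
if-false {b = true}  ¬t = contradiction _ ¬t

n*2≡n+n : ∀ n → n * 2 ≡ n + n
n*2≡n+n n = trans (*-comm n 2) (cong (n +_) (+-identityʳ n))

m*2≤n+o : ∀ {m n o} → m ≤ n → m ≤ o → m * 2 ≤ n + o
m*2≤n+o {m} {n} {o} m≤n m≤o = subst (_≤ n + o) (sym (n*2≡n+n m)) (+-mono-≤ m≤n m≤o)

n+o≤m*2 : ∀ {m n o} → n ≤ m → o ≤ m → n + o ≤ m * 2
n+o≤m*2 {m} {n} {o} n≤m o≤m = subst (n + o ≤_) (sym (n*2≡n+n m)) (+-mono-≤ n≤m o≤m)

m*2<n+o : ∀ {m n o} → m ≤ n → m < o → m * 2 < n + o
m*2<n+o {m} {n} {o} m≤n m<o = subst (_< n + o) (sym (n*2≡n+n m)) (+-mono-≤-< m≤n m<o)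

m+n≡o⇒o∸m≡n : ∀ {m n o} → m + n ≡ o → o ∸ m ≡ n
m+n≡o⇒o∸m≡n {m} {n} refl = m+n∸m≡n m n

squeeze : ∀ {c e} → c ≤ e → e ≤ suc c → e ≡ c ⊎ e ≡ suc c
squeeze c≤e e≤1+c with m≤n⇒m<n∨m≡n e≤1+c
... | inj₁ e<1+c = inj₁ (≤-antisym (≤-pred e<1+c) c≤e)
... | inj₂ e≡1+c = inj₂ e≡1+c

strictMono-reflects-< : {f : ℕ → ℕ} → f Preserves _<_ ⟶ _<_ → f x < f y → x < y
strictMono-reflects-< {x} {y} {f} mono fx<fy with <-cmp x y
... | tri< x<y _ _ = x<y
... | tri≈ _ refl _ = contradiction fx<fy (<-irrefl refl)
... | tri> _ _ y<x = contradiction fx<fy (<-asym (mono y<x))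

data Runs (m : ℕ) : ℕ → Set where
  first  : ∀ {j} → j < m → Runs m j
  second : ∀ k → Runs m (m + k)

runs : ∀ m j → Runs m j
runs m j with j <? m
... | yes j<m = first j<m
... | no  j≮m with m≤n⇒∃[o]m+o≡n (≮⇒≥ j≮m)
...   | k , refl = second k

data EvenOdd : ℕ → Set where
  even : ∀ k → EvenOdd (k * 2)
  odd  : ∀ k → EvenOdd (suc (k * 2))

evenOdd : ∀ j → EvenOdd j
evenOdd zero = even 0
evenOdd (suc j) with evenOdd j
... | even k = odd k
... | odd  k = even (suc k)

halve : ∀ p → ∃₂ λ c e → c ≤ e × e ≤ suc c × c + e ≡ p
halve p with evenOdd p
... | even k = k , k , ≤-refl , n≤1+n k , sym (n*2≡n+n k)
... | odd  k = k , suc k , n≤1+n k , ≤-refl , trans (+-suc k k) (cong suc (sym (n*2≡n+n k)))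

halves-bound : ∀ {n c e} → c ≤ e → e ≤ suc c → c + e ≤ n * 2 → e ≤ n
halves-bound {n} {c} {e} c≤e e≤1+c c+e≤2n = ≮⇒≥ λ n<e →
  <⇒≱ (subst (_< c + e) (sym (n*2≡n+n n)) (+-mono-≤-< (≤-pred (≤-trans n<e e≤1+c)) n<e)) c+e≤2n

-- Opaque, so that rewriting with the lemmas below sees skip p x, not its with-function.
opaque
  skip : ℕ → ℕ → ℕ
  skip p x with x <? p
  ... | yes _ = x
  ... | no  _ = suc x

  skip-< : x < p → skip p x ≡ x
  skip-< {x} {p} x<p with x <? p
  ... | yes _   = refl
  ... | no  x≮p = contradiction x<p x≮p

  skip-≥ : p ≤ x → skip p x ≡ suc x
  skip-≥ {p} {x} p≤x with x <? p
  ... | yes x<p = contradiction p≤x (<⇒≱ x<p)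
  ... | no  _   = refl

  skip-≤-suc : skip p x ≤ suc x
  skip-≤-suc {p} {x} with x <? p
  ... | yes _ = n≤1+n x
  ... | no  _ = ≤-refl

skip-strictMono : skip p Preserves _<_ ⟶ _<_
skip-strictMono {p} {x} {y} x<y with p ≤? y
... | yes p≤y = subst (skip p x <_) (sym (skip-≥ p≤y)) (s≤s (≤-trans skip-≤-suc x<y))
... | no  p≰y = subst₂ _<_ (sym (skip-< (<-trans x<y y<p))) (sym (skip-< y<p)) x<y
  where
  y<p : y < p
  y<p = ≰⇒> p≰y

skip-surjective : x ≢ p → ∃ λ a → skip p a ≡ x
skip-surjective {x} {p} x≢p with <-cmp x p
... | tri< x<p _ _ = x , skip-< x<p
... | tri≈ _ x≡p _ = contradiction x≡p x≢p
skip-surjective {suc x} {p} _ | tri> _ _ p<1+x = x , skip-≥ (≤-pred p<1+x)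

-- For p ≤ q, the increasing injection whose image misses exactly p and suc q.
skipTwo : ℕ → ℕ → ℕ → ℕ
skipTwo p q x = skip (suc q) (skip p x)

module _ (p≤q : p ≤ q) where

  skipTwo-< : x < p → skipTwo p q x ≡ x
  skipTwo-< x<p rewrite skip-< x<p = skip-< (s≤s (<⇒≤ (<-≤-trans x<p p≤q)))

  skipTwo-mid : p ≤ x → x < q → skipTwo p q x ≡ suc x
  skipTwo-mid p≤x x<q rewrite skip-≥ p≤x = skip-< (s≤s x<q)

  skipTwo-≥ : q ≤ x → skipTwo p q x ≡ suc (suc x)
  skipTwo-≥ q≤x rewrite skip-≥ (≤-trans p≤q q≤x) = skip-≥ (s≤s q≤x)

  skipTwo-surjective : x ≢ p → x ≢ suc q → ∃ λ a → skipTwo p q a ≡ x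
  skipTwo-surjective x≢p x≢1+q with skip-surjective x≢1+q
  ... | y , refl with skip-surjective y≢p
    where
    y≢p : y ≢ p
    y≢p refl = x≢p (skip-< (s≤s p≤q))
  ... | a , refl = a , refl

skipTwo-strictMono : ∀ p q → skipTwo p q Preserves _<_ ⟶ _<_
skipTwo-strictMono p q = skip-strictMono {suc q} ∘′ skip-strictMono {p}

CoversAllBut : ∀ {k K} {σ : Fin k → ℕ} {π : Fin K → ℕ} → Occurrence σ π → ℕ → ℕ → Set
CoversAllBut {k} {K} occ d₁ d₂ =
  ∀ (x : Fin K) → toℕ x ≢ d₁ → toℕ x ≢ d₂ → ∃ λ (a : Fin k) → Occurrence.pos occ a ≡ x

occurrence-skipping : ∀ {k K} (σ : Fin k → ℕ) (π : Fin K → ℕ) {p q : ℕ} (f : ℕ → ℕ) →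
  K ≡ suc (suc k) → p ≤ q → q ≤ k → f Preserves _<_ ⟶ _<_ →
  (∀ a b → toℕ b ≡ skipTwo p q (toℕ a) → π b ≡ f (σ a)) →
  Σ (Occurrence σ π) (λ occ → CoversAllBut occ p (suc q))
occurrence-skipping {k} {K} σ π {p} {q} f refl p≤q q≤k f-mono π≡f∘σ = occ , covers
  where
  skipTwo-k : skipTwo p q k ≡ suc (suc k)
  skipTwo-k = skipTwo-≥ p≤q q≤k

  pos-bound : (a : Fin k) → skipTwo p q (toℕ a) < K
  pos-bound a = subst (skipTwo p q (toℕ a) <_) skipTwo-k (skipTwo-strictMono p q (toℕ<n a))

  pos : Fin k → Fin K
  pos a = fromℕ< (pos-bound a)

  toℕ-pos : ∀ a → toℕ (pos a) ≡ skipTwo p q (toℕ a)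
  toℕ-pos a = toℕ-fromℕ< (pos-bound a)

  π∘pos : ∀ a → π (pos a) ≡ f (σ a)
  π∘pos a = π≡f∘σ a (pos a) (toℕ-pos a)

  occ : Occurrence σ π
  occ = record
    { pos        = pos
    ; increasing = λ a b a<b →
        subst₂ _<_ (sym (toℕ-pos a)) (sym (toℕ-pos b)) (skipTwo-strictMono p q a<b)
    ; orderIso   = λ a b →
        (λ σa<σb → subst₂ _<_ (sym (π∘pos a)) (sym (π∘pos b)) (f-mono σa<σb))
      , (λ πa<πb → strictMono-reflects-< f-mono (subst₂ _<_ (π∘pos a) (π∘pos b) πa<πb)) }

  covers : CoversAllBut occ p (suc q)
  covers x x≢p x≢1+q with skipTwo-surjective p≤q x≢p x≢1+q
  ... | a , eq = fromℕ< a<k , toℕ-injective (begin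
      toℕ (pos (fromℕ< a<k))         ≡⟨ toℕ-pos _ ⟩
      skipTwo p q (toℕ (fromℕ< a<k)) ≡⟨ cong (skipTwo p q) (toℕ-fromℕ< a<k) ⟩
      skipTwo p q a                  ≡⟨ eq ⟩
      toℕ x                          ∎)
    where
    open ≡-Reasoning
    a<k : a < k
    a<k = strictMono-reflects-< (skipTwo-strictMono p q)
            (subst₂ _<_ (sym eq) (sym skipTwo-k) (toℕ<n x))

occurrence-reverse : ∀ {k K} {σ σ′ : Fin k → ℕ} {π π′ : Fin K → ℕ} {d₁ d₂ e₁ e₂ : ℕ} →
  (∀ a → σ′ a ≡ σ (opposite a)) → (∀ b → π′ b ≡ π (opposite b)) →
  suc (d₁ + e₁) ≡ K → suc (d₂ + e₂) ≡ K →
  Σ (Occurrence σ π) (λ occ → CoversAllBut occ d₁ d₂) →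
  Σ (Occurrence σ′ π′) (λ occ → CoversAllBut occ e₁ e₂)
occurrence-reverse {k} {K} {_} {σ′} {π} {π′} {_} {_} {e₁} {e₂} σ′≡ π′≡ K≡₁ K≡₂ (occ , covers) =
  occ′ , covers′
  where
  open Occurrence occ

  pos′ : Fin k → Fin K
  pos′ = opposite ∘ pos ∘ opposite

  opposite-reverses : ∀ {n} (x y : Fin n) → toℕ x < toℕ y → toℕ (opposite y) < toℕ (opposite x)
  opposite-reverses x y x<y rewrite opposite-prop x | opposite-prop y = ∸-monoʳ-< (s≤s x<y) (toℕ<n y)

  π′∘pos′ : ∀ a → π′ (pos′ a) ≡ π (pos (opposite a))
  π′∘pos′ a = trans (π′≡ (pos′ a)) (cong π (opposite-involutive (pos (opposite a))))

  occ′ : Occurrence σ′ π′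
  occ′ = record
    { pos        = pos′
    ; increasing = λ a b a<b →
        opposite-reverses (pos (opposite b)) (pos (opposite a))
          (increasing (opposite b) (opposite a) (opposite-reverses a b a<b))
    ; orderIso   = λ a b →
        (λ h → subst₂ _<_ (sym (π′∘pos′ a)) (sym (π′∘pos′ b))
                 (proj₁ (orderIso (opposite a) (opposite b)) (subst₂ _<_ (σ′≡ a) (σ′≡ b) h)))
      , (λ h → subst₂ _<_ (sym (σ′≡ a)) (sym (σ′≡ b))
                 (proj₂ (orderIso (opposite a) (opposite b)) (subst₂ _<_ (π′∘pos′ a) (π′∘pos′ b) h))) }

  opposite-avoids : ∀ {d e} → suc (d + e) ≡ K → (x : Fin K) → toℕ x ≢ e → toℕ (opposite x) ≢ d
  opposite-avoids {d} {e} K≡ x x≢e opp≡d = x≢e (+-cancelˡ-≡ (suc d) (toℕ x) e (begin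
    suc d + toℕ x                   ≡⟨ cong (λ y → suc y + toℕ x) opp≡d ⟨
    suc (toℕ (opposite x)) + toℕ x  ≡⟨ cong (λ y → suc y + toℕ x) (opposite-prop x) ⟩
    suc (K ∸ suc (toℕ x)) + toℕ x   ≡⟨ +-suc (K ∸ suc (toℕ x)) (toℕ x) ⟨ 
    K ∸ suc (toℕ x) + suc (toℕ x)   ≡⟨ m∸n+n≡m (toℕ<n x) ⟩
    K                               ≡⟨ K≡ ⟨
    suc d + e                       ∎))
    where open ≡-Reasoning

  covers′ : CoversAllBut occ′ e₁ e₂
  covers′ x x≢e₁ x≢e₂ with covers (opposite x) (opposite-avoids K≡₁ x x≢e₁) (opposite-avoids K≡₂ x x≢e₂)
  ... | a , pos-a≡ = opposite a , (begin
    opposite (pos (opposite (opposite a)))  ≡⟨ cong (opposite ∘ pos) (opposite-involutive a) ⟩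
    opposite (pos a)                        ≡⟨ cong opposite pos-a≡ ⟩
    opposite (opposite x)                   ≡⟨ opposite-involutive x ⟩
    x                                       ∎)
    where open ≡-Reasoning

exc1-first : j < m → exc type1 m j ≡ suc j * 2
exc1-first {j} {m} j<m = trans (if-true (<⇒<ᵇ j<m)) (trans (*-comm 2 (j + 1)) (cong (_* 2) (+-comm j 1)))

exc1-second : ∀ m k → exc type1 m (m + k) ≡ suc (k * 2)
exc1-second m k = begin
  exc type1 m (m + k)  ≡⟨ if-false (λ t → m+n≮m m k (<ᵇ⇒< (m + k) m t)) ⟩
  2 * (m + k ∸ m) + 1  ≡⟨ cong (λ x → 2 * x + 1) (m+n∸m≡n m k) ⟩
  2 * k + 1            ≡⟨ +-comm (2 * k) 1 ⟩
  suc (2 * k)          ≡⟨ cong suc (*-comm 2 k) ⟩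
  suc (k * 2)          ∎
  where open ≡-Reasoning

exc3-even : ∀ m k → exc type3 m (k * 2) ≡ suc (m + k)
exc3-even m k = begin
  exc type3 m (k * 2)  ≡⟨ if-true (subst (λ r → T (r <ᵇ 1)) (sym (m*n%n≡0 k 2)) _) ⟩
  m + 1 + k * 2 / 2    ≡⟨ cong (m + 1 +_) (m*n/n≡m k 2) ⟩
  m + 1 + k            ≡⟨ cong (_+ k) (+-comm m 1) ⟩
  suc (m + k)          ∎
  where open ≡-Reasoning

[1+k*2]/2≡k : ∀ k → suc (k * 2) / 2 ≡ k
[1+k*2]/2≡k k = trans (+-distrib-/ 1 (k * 2) 1%2+k*2%2<2) (m*n/n≡m k 2)
  where
  1%2+k*2%2<2 : 1 % 2 + k * 2 % 2 < 2
  1%2+k*2%2<2 = subst (λ r → 1 + r < 2) (sym (m*n%n≡0 k 2)) ≤-refl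

exc3-odd : ∀ m k → exc type3 m (suc (k * 2)) ≡ suc k
exc3-odd m k = begin
  exc type3 m (suc (k * 2))  ≡⟨ if-false (subst (λ r → ¬ T (r <ᵇ 1)) (sym ([m+kn]%n≡m%n 1 k 2)) (λ ())) ⟩
  suc (k * 2) / 2 + 1        ≡⟨ cong (_+ 1) ([1+k*2]/2≡k k) ⟩
  k + 1                      ≡⟨ +-comm k 1 ⟩
  suc k                      ∎
  where open ≡-Reasoning

-- Positions c and n + 1 + e of the longer permutation carry the values 2c + 2 and
-- 2e + 1, which are c + e + 1 and c + e + 2 in some order.
exc1-skipTwo : ∀ n c e → c ≤ e → e ≤ suc c → e ≤ n → ∀ a →
  exc type1 (suc n) (skipTwo c (n + e) a) ≡ skipTwo (suc (c + e)) (suc (c + e)) (exc type1 n a)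
exc1-skipTwo n c e c≤e e≤1+c e≤n a with runs n a | ≤-trans c≤e (m≤n+m e n)
... | first {j} j<n | c≤n+e with j <? c
...   | yes j<c
  rewrite skipTwo-< c≤n+e j<c | exc1-first (m<n⇒m<1+n j<n) | exc1-first j<n
        | skipTwo-< ≤-refl (s≤s (m*2≤n+o j<c (≤-trans j<c c≤e))) = refl
...   | no  j≮c
  rewrite skipTwo-mid c≤n+e (≮⇒≥ j≮c) (<-≤-trans j<n (m≤m+n n e))
        | exc1-first (s≤s j<n) | exc1-first j<n
        | skipTwo-≥ ≤-refl (n+o≤m*2 (s≤s (≮⇒≥ j≮c)) (≤-trans e≤1+c (s≤s (≮⇒≥ j≮c)))) = refl
exc1-skipTwo n c e c≤e e≤1+c e≤n a | second k | c≤n+e with k <? e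
... | yes k<e
  rewrite skipTwo-mid c≤n+e (≤-trans c≤e (≤-trans e≤n (m≤m+n n k))) (+-monoʳ-< n k<e)
        | exc1-second (suc n) k | exc1-second n k
        | skipTwo-< ≤-refl (m*2≤n+o (s≤s (≤-pred (<-≤-trans k<e e≤1+c))) k<e) = refl
... | no  k≮e = begin
  exc type1 (suc n) (skipTwo c (n + e) (n + k))
    ≡⟨ cong (exc type1 (suc n)) (trans (skipTwo-≥ c≤n+e (+-monoʳ-≤ n e≤k)) (cong suc (sym (+-suc n k)))) ⟩
  exc type1 (suc n) (suc n + suc k)
    ≡⟨ exc1-second (suc n) (suc k) ⟩
  suc (suc k * 2)
    ≡⟨ skipTwo-≥ ≤-refl (s≤s (n+o≤m*2 (≤-trans c≤e e≤k) e≤k)) ⟨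
  skipTwo (suc (c + e)) (suc (c + e)) (suc (k * 2))
    ≡⟨ cong (skipTwo (suc (c + e)) (suc (c + e))) (exc1-second n k) ⟨
  skipTwo (suc (c + e)) (suc (c + e)) (exc type1 n (n + k)) ∎
  where
  open ≡-Reasoning
  e≤k : e ≤ k
  e≤k = ≮⇒≥ k≮e

-- Positions c + e and c + e + 1 of the longer permutation are 2c + 1 and 2e in some
-- order, carrying the values c + 1 and n + 2 + e.
exc3-skipTwo : ∀ n c e → c ≤ e → e ≤ suc c → e ≤ n → ∀ a → a < n * 2 →
  exc type3 (suc n) (skipTwo (c + e) (c + e) a) ≡ skipTwo (suc c) (suc (n + e)) (exc type3 n a)
exc3-skipTwo n c e c≤e e≤1+c e≤n a a<2n with evenOdd a | s≤s (≤-trans c≤e (m≤n+m e n))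
... | even k | 1+c≤1+n+e with k <? e
...   | yes k<e
  rewrite skipTwo-< ≤-refl (m*2<n+o (≤-pred (<-≤-trans k<e e≤1+c)) k<e)
        | exc3-even (suc n) k | exc3-even n k
        | skipTwo-mid 1+c≤1+n+e (s≤s (≤-trans c≤e (≤-trans e≤n (m≤m+n n k)))) (s≤s (+-monoʳ-< n k<e)) = refl
...   | no  k≮e
  rewrite skipTwo-≥ ≤-refl (n+o≤m*2 (≤-trans c≤e (≮⇒≥ k≮e)) (≮⇒≥ k≮e))
        | exc3-even (suc n) (suc k) | exc3-even n k
        | skipTwo-≥ 1+c≤1+n+e (s≤s (+-monoʳ-≤ n (≮⇒≥ k≮e))) | +-suc n k = refl
exc3-skipTwo n c e c≤e e≤1+c e≤n a a<2n | odd k | 1+c≤1+n+e with k <? c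
... | yes k<c
  rewrite skipTwo-< ≤-refl (m*2≤n+o k<c (<-≤-trans k<c c≤e))
        | exc3-odd (suc n) k | exc3-odd n k | skipTwo-< 1+c≤1+n+e (s≤s k<c) = refl
... | no  k≮c
  rewrite skipTwo-≥ ≤-refl (≤-pred (n+o≤m*2 (s≤s (≮⇒≥ k≮c)) (≤-trans e≤1+c (s≤s (≮⇒≥ k≮c)))))
        | exc3-odd (suc n) (suc k) | exc3-odd n k
        | skipTwo-mid 1+c≤1+n+e (s≤s (≮⇒≥ k≮c)) (s≤s (≤-trans (*-cancelʳ-≤ (suc k) n 2 a<2n) (m≤m+n n e))) = refl

exc2-reverse : ∀ m j → j < 2 * m → exc type2 m j ≡ exc type1 m (2 * m ∸ suc j)
exc2-reverse m j j<2m with runs m j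
... | first j<m with m≤n⇒∃[o]m+o≡n j<m
...   | d , refl = begin
  exc type2 m j                ≡⟨ if-true (<⇒<ᵇ j<m) ⟩
  2 * m ∸ (2 * j + 1)          ≡⟨ m+n≡o⇒o∸m≡n (value-split j d) ⟩
  suc (d * 2)                  ≡⟨ exc1-second m d ⟨
  exc type1 m (m + d)          ≡⟨ cong (exc type1 m) (m+n≡o⇒o∸m≡n {suc j} (index-split j d)) ⟨
  exc type1 m (2 * m ∸ suc j)  ∎
  where
  open ≡-Reasoning
  value-split : ∀ j d → (2 * j + 1) + suc (d * 2) ≡ 2 * (suc j + d)
  value-split = solve-∀
  index-split : ∀ j d → suc j + (suc j + d + d) ≡ 2 * (suc j + d)
  index-split = solve-∀
exc2-reverse m j j<2m | second k
  with m≤n⇒∃[o]m+o≡n (+-cancelˡ-< m k m (subst (m + k <_) (cong (m +_) (+-identityʳ m)) j<2m))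
... | d , refl = begin
  exc type2 m (m + k)                ≡⟨ if-false (λ t → m+n≮m m k (<ᵇ⇒< (m + k) m t)) ⟩
  2 * m ∸ 2 * (m + k ∸ m)            ≡⟨ cong (λ x → 2 * m ∸ 2 * x) (m+n∸m≡n m k) ⟩
  2 * m ∸ 2 * k                      ≡⟨ m+n≡o⇒o∸m≡n (value-split k d) ⟩
  suc d * 2                          ≡⟨ exc1-first (s≤s (m≤n+m d k)) ⟨
  exc type1 m d                      ≡⟨ cong (exc type1 m) (m+n≡o⇒o∸m≡n {suc (m + k)} (index-split k d)) ⟨
  exc type1 m (2 * m ∸ suc (m + k))  ∎
  where
  open ≡-Reasoning
  value-split : ∀ k d → 2 * k + suc d * 2 ≡ 2 * (suc k + d)
  value-split = solve-∀
  index-split : ∀ k d → suc (suc k + d + k) + d ≡ 2 * (suc k + d)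
  index-split = solve-∀

exc4-reverse : ∀ m j → j < 2 * m → exc type4 m j ≡ exc type3 m (2 * m ∸ suc j)
exc4-reverse m j j<2m with evenOdd j
... | even k with m≤n⇒∃[o]m+o≡n (*-cancelʳ-< _ k m (subst (k * 2 <_) (*-comm 2 m) j<2m))
...   | d , refl = begin
  exc type4 m (k * 2)                ≡⟨ if-true (subst (λ r → T (r <ᵇ 1)) (sym (m*n%n≡0 k 2)) _) ⟩
  m ∸ k * 2 / 2                      ≡⟨ cong (m ∸_) (m*n/n≡m k 2) ⟩
  m ∸ k                              ≡⟨ m+n≡o⇒o∸m≡n (+-suc k d) ⟩
  suc d                              ≡⟨ exc3-odd m d ⟨
  exc type3 m (suc (d * 2))          ≡⟨ cong (exc type3 m) (m+n≡o⇒o∸m≡n {suc (k * 2)} (index-split k d)) ⟨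
  exc type3 m (2 * m ∸ suc (k * 2))  ∎
  where
  open ≡-Reasoning
  index-split : ∀ k d → suc (k * 2) + suc (d * 2) ≡ 2 * suc (k + d)
  index-split = solve-∀
exc4-reverse m j j<2m | odd k
  with m≤n⇒∃[o]m+o≡n (*-cancelʳ-< _ k m (<-trans (n<1+n (k * 2)) (subst (suc (k * 2) <_) (*-comm 2 m) j<2m)))
... | d , refl = begin
  exc type4 m (suc (k * 2))                ≡⟨ if-false (subst (λ r → ¬ T (r <ᵇ 1)) (sym ([m+kn]%n≡m%n 1 k 2)) (λ ())) ⟩
  2 * m ∸ suc (k * 2) / 2                  ≡⟨ cong (2 * m ∸_) ([1+k*2]/2≡k k) ⟩
  2 * m ∸ k                                ≡⟨ m+n≡o⇒o∸m≡n (value-split k d) ⟩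
  suc (m + d)                              ≡⟨ exc3-even m d ⟨
  exc type3 m (d * 2)                      ≡⟨ cong (exc type3 m) (m+n≡o⇒o∸m≡n {suc (suc (k * 2))} (index-split k d)) ⟨
  exc type3 m (2 * m ∸ suc (suc (k * 2)))  ∎
  where
  open ≡-Reasoning
  value-split : ∀ k d → k + suc (suc (k + d) + d) ≡ 2 * suc (k + d)
  value-split = solve-∀
  index-split : ∀ k d → suc (suc (k * 2)) + d * 2 ≡ 2 * suc (k + d)
  index-split = solve-∀

excPerm-reverse : ∀ {t t′} → (∀ m j → j < 2 * m → exc t′ m j ≡ exc t m (2 * m ∸ suc j)) →
  ∀ m (a : Fin (2 * m)) → excPerm t′ m a ≡ excPerm t m (opposite a)
excPerm-reverse {t} reverse m a =
  trans (reverse m (toℕ a) (toℕ<n a)) (cong (exc t m) (sym (opposite-prop a)))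

OccurrenceAvoiding : ExcType → ℕ → ℕ → ℕ → Set
OccurrenceAvoiding t n d₁ d₂ =
  Σ (Occurrence (excPerm t n) (excPerm t (suc n))) (λ occ → CoversAllBut occ d₁ d₂)

type1-occurrence : ∀ n c e → c ≤ e → e ≤ suc c → e ≤ n → OccurrenceAvoiding type1 n c (suc (n + e))
type1-occurrence n c e c≤e e≤1+c e≤n =
  occurrence-skipping _ _ (skipTwo (suc (c + e)) (suc (c + e))) (*-suc 2 n) (≤-trans c≤e (m≤n+m e n))
    (+-monoʳ-≤ n (subst (e ≤_) (sym (+-identityʳ n)) e≤n)) (skipTwo-strictMono _ _)
    (λ a b b≡ → trans (cong (exc type1 (suc n)) b≡) (exc1-skipTwo n c e c≤e e≤1+c e≤n (toℕ a)))

type3-occurrence : ∀ n c e → c ≤ e → e ≤ suc c → e ≤ n → OccurrenceAvoiding type3 n (c + e) (suc (c + e))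
type3-occurrence n c e c≤e e≤1+c e≤n =
  occurrence-skipping _ _ (skipTwo (suc c) (suc (n + e))) (*-suc 2 n) ≤-refl
    (subst (c + e ≤_) (sym (cong (n +_) (+-identityʳ n))) (+-mono-≤ (≤-trans c≤e e≤n) e≤n)) (skipTwo-strictMono _ _)
    (λ a b b≡ → trans (cong (exc type3 (suc n)) b≡)
                      (exc3-skipTwo n c e c≤e e≤1+c e≤n (toℕ a) (subst (toℕ a <_) (*-comm 2 n) (toℕ<n a))))

-- (i, r) = (n ∸ e, n ∸ c): reversing the 2n + 2 positions turns the pairs deleted for
-- types 1 and 3 with parameters (i, r) into those deleted for types 2 and 4 with (c, e).
mirror : ∀ {n c e} → c ≤ e → e ≤ suc c → e ≤ n →
  ∃₂ λ i r → i ≤ r × r ≤ suc i × r ≤ n × i + e ≡ n × c + r ≡ n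
mirror {c = c} {e} c≤e e≤1+c e≤n with m≤n⇒∃[o]m+o≡n e≤n | squeeze c≤e e≤1+c
... | i , refl | inj₁ refl = i , i , ≤-refl , n≤1+n i , m≤n+m i c , +-comm i c , refl
... | i , refl | inj₂ refl = i , suc i , n≤1+n i , ≤-refl , s≤s (m≤n+m i c) , +-comm i (suc c) , +-suc c i

opposite-position : ∀ {n x y} → x + y ≡ n → suc (x + suc (n + y)) ≡ 2 * suc n
opposite-position {x = x} {y} refl = identity x y
  where
  identity : ∀ x y → suc (x + suc (x + y + y)) ≡ 2 * suc (x + y)
  identity = solve-∀

excPerm-type2 : ∀ m (a : Fin (2 * m)) → excPerm type2 m a ≡ excPerm type1 m (opposite a)
excPerm-type2 = excPerm-reverse {type1} {type2} exc2-reverse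

excPerm-type4 : ∀ m (a : Fin (2 * m)) → excPerm type4 m a ≡ excPerm type3 m (opposite a)
excPerm-type4 = excPerm-reverse {type3} {type4} exc4-reverse

type2-occurrence : ∀ n c e → c ≤ e → e ≤ suc c → e ≤ n → OccurrenceAvoiding type2 n (suc (n + e)) c
type2-occurrence n c e c≤e e≤1+c e≤n with mirror c≤e e≤1+c e≤n
... | i , r , i≤r , r≤1+i , r≤n , i+e≡n , c+r≡n =
  occurrence-reverse (excPerm-type2 n) (excPerm-type2 (suc n))
    (opposite-position i+e≡n) (trans (cong suc (+-comm (suc (n + r)) c)) (opposite-position c+r≡n))
    (type1-occurrence n i r i≤r r≤1+i r≤n)

mirror-sum : ∀ {n} i r c e → i + e ≡ n → c + r ≡ n → suc (suc (i + r + (c + e))) ≡ 2 * suc n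
mirror-sum {n} i r c e i+e≡n c+r≡n = begin
  suc (suc (i + r + (c + e)))  ≡⟨ cong (λ x → suc (suc x)) (rearrange i r c e) ⟩
  suc (suc ((i + e) + (c + r)))  ≡⟨ cong₂ (λ x y → suc (suc (x + y))) i+e≡n c+r≡n ⟩
  suc (suc (n + n))            ≡⟨ double n ⟩
  2 * suc n                    ∎
  where
  open ≡-Reasoning
  rearrange : ∀ i r c e → i + r + (c + e) ≡ (i + e) + (c + r)
  rearrange = solve-∀
  double : ∀ n → suc (suc (n + n)) ≡ 2 * suc n
  double = solve-∀

type4-occurrence : ∀ n c e → c ≤ e → e ≤ suc c → e ≤ n → OccurrenceAvoiding type4 n (suc (c + e)) (c + e)
type4-occurrence n c e c≤e e≤1+c e≤n with mirror c≤e e≤1+c e≤n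
... | i , r , i≤r , r≤1+i , r≤n , i+e≡n , c+r≡n =
  occurrence-reverse (excPerm-type4 n) (excPerm-type4 (suc n))
    (trans (cong suc (+-suc (i + r) (c + e))) sum≡) sum≡ (type3-occurrence n i r i≤r r≤1+i r≤n)
  where
  sum≡ : suc (suc (i + r + (c + e))) ≡ 2 * suc n
  sum≡ = mirror-sum i r c e i+e≡n c+r≡n

at : List Bool → ℕ → Bool
at []       _       = false
at (x ∷ _)  zero    = x
at (_ ∷ xs) (suc i) = at xs i

trues : List Bool → ℕ
trues []           = 0
trues (true  ∷ xs) = suc (trues xs)
trues (false ∷ xs) = trues xs

trues-++ : ∀ xs ys → trues (xs ++ ys) ≡ trues xs + trues ys
trues-++ []           ys = refl
trues-++ (true  ∷ xs) ys = cong suc (trues-++ xs ys)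
trues-++ (false ∷ xs) ys = trues-++ xs ys

at-take : ∀ N xs {i} → i < N → at (take N xs) i ≡ at xs i
at-take (suc N) []       _       = refl
at-take (suc N) (x ∷ xs) {zero}  _         = refl
at-take (suc N) (x ∷ xs) {suc i} (s≤s i<N) = at-take N xs i<N

at-drop : ∀ N xs i → at (drop N xs) i ≡ at xs (N + i)
at-drop zero    xs       i = refl
at-drop (suc N) []       i = refl
at-drop (suc N) (x ∷ xs) i = at-drop N xs i

trues-toList : ∀ {L} (P : Subset L) → trues (toList P) ≡ ∣ P ∣
trues-toList []ᵥ           = refl
trues-toList (true  ∷ᵥ P) = cong suc (trues-toList P)
trues-toList (false ∷ᵥ P) = trues-toList P

at-toList : ∀ {L} (P : Subset L) (x : Fin L) → at (toList P) (toℕ x) ≡ lookup P x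
at-toList (b ∷ᵥ P) fzero    = refl
at-toList (b ∷ᵥ P) (fsuc x) = at-toList P x

adjacent-falses : ∀ xs → suc (suc (trues xs * 2)) ≤ length xs →
  ∃ λ p → suc p < length xs × at xs p ≡ false × at xs (suc p) ≡ false
adjacent-falses (true ∷ xs) (s≤s h) with adjacent-falses xs (≤-trans (n≤1+n _) h)
... | p , bound , free₁ , free₂ = suc p , s≤s bound , free₁ , free₂
adjacent-falses (false ∷ []) (s≤s ())
adjacent-falses (false ∷ false ∷ xs) _ = 0 , s≤s (s≤s z≤n) , refl , refl
adjacent-falses (false ∷ true ∷ xs) (s≤s (s≤s h)) with adjacent-falses xs h
... | p , bound , free₁ , free₂ = suc (suc p) , s≤s (s≤s bound) , free₁ , free₂

interleave : List Bool → List Bool → List Bool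
interleave []       as       = as
interleave (b ∷ bs) []       = b ∷ bs
interleave (b ∷ bs) (a ∷ as) = b ∷ a ∷ interleave bs as

length-interleave : ∀ bs as → length (interleave bs as) ≡ length bs + length as
length-interleave []       as       = refl
length-interleave (b ∷ bs) []       = cong suc (sym (+-identityʳ _))
length-interleave (b ∷ bs) (a ∷ as) =
  cong suc (trans (cong suc (length-interleave bs as)) (sym (+-suc _ _)))

trues-interleave : ∀ bs as → trues (interleave bs as) ≡ trues bs + trues as
trues-interleave []           as           = refl
trues-interleave (b ∷ bs)     []           = sym (+-identityʳ _)
trues-interleave (true ∷ bs)  (true ∷ as)  = cong suc (trans (cong suc (trues-interleave bs as)) (sym (+-suc _ _)))
trues-interleave (true ∷ bs)  (false ∷ as) = cong suc (trues-interleave bs as)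
trues-interleave (false ∷ bs) (true ∷ as)  = trans (cong suc (trues-interleave bs as)) (sym (+-suc _ _))
trues-interleave (false ∷ bs) (false ∷ as) = trues-interleave bs as

at-interleave-even : ∀ bs as → length bs ≡ length as → ∀ k → at (interleave bs as) (k * 2) ≡ at bs k
at-interleave-even []       []       _  k       = refl
at-interleave-even (b ∷ bs) (a ∷ as) _  zero    = refl
at-interleave-even (b ∷ bs) (a ∷ as) eq (suc k) = at-interleave-even bs as (suc-injective eq) k

at-interleave-odd : ∀ bs as → length bs ≡ length as → ∀ k → at (interleave bs as) (suc (k * 2)) ≡ at as k
at-interleave-odd []       []       _  k       = refl
at-interleave-odd (b ∷ bs) (a ∷ as) _  zero    = refl
at-interleave-odd (b ∷ bs) (a ∷ as) eq (suc k) = at-interleave-odd bs as (suc-injective eq) k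

at-interleave-halves : ∀ bs as → length bs ≡ length as → ∀ {c e} → c ≤ e → e ≤ suc c →
  at (interleave bs as) (c + e) ≡ false → at (interleave bs as) (suc (c + e)) ≡ false →
  at as c ≡ false × at bs e ≡ false
at-interleave-halves bs as len≡ {c} c≤e e≤1+c free₁ free₂ with squeeze c≤e e≤1+c
... | inj₁ refl rewrite sym (n*2≡n+n c) =
  trans (sym (at-interleave-odd bs as len≡ c)) free₂ , trans (sym (at-interleave-even bs as len≡ c)) free₁
... | inj₂ refl rewrite +-suc c c | sym (n*2≡n+n c) =
  trans (sym (at-interleave-odd bs as len≡ c)) free₁ , trans (sym (at-interleave-even bs as len≡ (suc c))) free₂

-- c ≤ e ≤ suc c says that c and e are the lower and upper halves of c + e.
FreeHalves : ℕ → (ℕ → ℕ → ℕ) → (ℕ → ℕ → ℕ) → List Bool → Set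
FreeHalves n d₁ d₂ ys =
  ∃₂ λ c e → c ≤ e × e ≤ suc c × e ≤ n × at ys (d₁ c e) ≡ false × at ys (d₂ c e) ≡ false

halves-of-adjacent-falses : ∀ n ys → length ys ≡ suc n * 2 → trues ys ≡ n →
  FreeHalves n _+_ (λ c e → suc (c + e)) ys
halves-of-adjacent-falses n ys len≡ trues≡
  with adjacent-falses ys (≤-reflexive (trans (cong (λ t → suc (suc (t * 2))) trues≡) (sym len≡)))
... | p , p<len , free₁ , free₂ with halve p
...   | c , e , c≤e , e≤1+c , refl =
  c , e , c≤e , e≤1+c , halves-bound c≤e e≤1+c (≤-pred (≤-pred (subst (suc (c + e) <_) len≡ p<len))) , free₁ , free₂

module _ {n : ℕ} (P : Subset (2 * suc n)) (|P|≡n : ∣ P ∣ ≡ n) where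

  private
    N : ℕ
    N = suc n

    xs : List Bool
    xs = toList P

    length-xs : length xs ≡ N * 2
    length-xs = trans (length-toList P) (*-comm 2 N)

    trues-xs : trues xs ≡ n
    trues-xs = trans (trues-toList P) |P|≡n

    length-take-xs : length (take N xs) ≡ N
    length-take-xs = trans (length-take N xs) (m≤n⇒m⊓n≡m (subst (N ≤_) (sym length-xs) (m≤m*n N 2)))

    length-drop-xs : length (drop N xs) ≡ N
    length-drop-xs = trans (length-drop N xs) (trans (cong (_∸ N) (trans length-xs (n*2≡n+n N))) (m+n∸m≡n N N))

    -- The positions N, 0, N + 1, 1, ...: its entries c + e and suc (c + e) are those of
    -- xs at c and N + e.
    zigzag : List Bool
    zigzag = interleave (drop N xs) (take N xs)

    length-zigzag : length zigzag ≡ N * 2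
    length-zigzag = trans (length-interleave (drop N xs) (take N xs))
                          (trans (cong₂ _+_ length-drop-xs length-take-xs) (sym (n*2≡n+n N)))

    trues-zigzag : trues zigzag ≡ n
    trues-zigzag = begin
      trues zigzag                           ≡⟨ trues-interleave (drop N xs) (take N xs) ⟩
      trues (drop N xs) + trues (take N xs)  ≡⟨ +-comm (trues (drop N xs)) _ ⟩
      trues (take N xs) + trues (drop N xs)  ≡⟨ trues-++ (take N xs) (drop N xs) ⟨
      trues (take N xs ++ drop N xs)         ≡⟨ cong trues (take++drop≡id N xs) ⟩
      trues xs                               ≡⟨ trues-xs ⟩
      n                                      ∎
      where open ≡-Reasoning

  free-adjacent-pair : FreeHalves n _+_ (λ c e → suc (c + e)) xs
  free-adjacent-pair = halves-of-adjacent-falses n xs length-xs trues-xs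

  free-crossing-pair : FreeHalves n (λ c e → c) (λ c e → suc (n + e)) xs
  free-crossing-pair with halves-of-adjacent-falses n zigzag length-zigzag trues-zigzag
  ... | c , e , c≤e , e≤1+c , e≤n , free₁ , free₂
    with at-interleave-halves (drop N xs) (take N xs) (trans length-drop-xs (sym length-take-xs)) c≤e e≤1+c free₁ free₂
  ... | free-c , free-N+e =
    c , e , c≤e , e≤1+c , e≤n ,
    trans (sym (at-take N xs (s≤s (≤-trans c≤e e≤n)))) free-c ,
    trans (sym (at-drop N xs e)) free-N+e

contains-if-avoided : ∀ {k K} {σ : Fin k → ℕ} {π : Fin K → ℕ} {d₁ d₂} (P : Subset K) →
  Σ (Occurrence σ π) (λ occ → CoversAllBut occ d₁ d₂) →
  at (toList P) d₁ ≡ false → at (toList P) d₂ ≡ false →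
  Σ (Occurrence σ π) (λ occ → Contains occ P)
contains-if-avoided P (occ , covers) free₁ free₂ =
  occ , λ x x∈P → covers x (outside free₁ x x∈P) (outside free₂ x x∈P)
  where
  outside : ∀ {d} → at (toList P) d ≡ false → ∀ x → x ∈ P → toℕ x ≢ d
  outside free x x∈P refl with trans (sym free) (trans (at-toList P x) ([]=⇒lookup x∈P))
  ... | ()

proposition4p2 : (n : ℕ) → 2 ≤ n → (t : ExcType) →
    (P : Subset (2 * suc n)) → ∣ P ∣ ≡ n →
    Σ (Occurrence (excPerm t n) (excPerm t (suc n))) (λ occ → Contains occ P)
proposition4p2 n _ type1 P |P|≡n =
  let c , e , c≤e , e≤1+c , e≤n , free₁ , free₂ = free-crossing-pair P |P|≡n
  in contains-if-avoided P (type1-occurrence n c e c≤e e≤1+c e≤n) free₁ free₂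
proposition4p2 n _ type2 P |P|≡n =
  let c , e , c≤e , e≤1+c , e≤n , free₁ , free₂ = free-crossing-pair P |P|≡n
  in contains-if-avoided P (type2-occurrence n c e c≤e e≤1+c e≤n) free₂ free₁
proposition4p2 n _ type3 P |P|≡n =
  let c , e , c≤e , e≤1+c , e≤n , free₁ , free₂ = free-adjacent-pair P |P|≡n
  in contains-if-avoided P (type3-occurrence n c e c≤e e≤1+c e≤n) free₁ free₂
proposition4p2 n _ type4 P |P|≡n =
  let c , e , c≤e , e≤1+c , e≤n , free₁ , free₂ = free-adjacent-pair P |P|≡n
  in contains-if-avoided P (type4-occurrence n c e c≤e e≤1+c e≤n) free₂ free₁
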